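{- For $n\ge1$ let $\Pi_n$ be the multigraph on $[n+1]$ with edges $(i,i+1)$ and $(i,n+1)$ for $i=1,\ldots,n$, and let $\mathbf a=(a_1,\ldots,a_n,-\sum_i a_i)$ with $a_i\in\mathbb{Z}_{>0}$. Then the number of types of cells of the canonical subdivision of $\mathcal{F}_{\Pi_n}(\mathbf a)$ is the Catalan number $C_n=\frac{1}{n+1}\binom{2n}{n}$.
   Context: For a directed multigraph $G$ on $[n+1]$ with edges $(i,j)$, $i<j$, $\mathcal{F}_G(\mathbf a)$ is the set of $f\in\mathbb{R}_{\ge0}^{E(G)}$ with (outflow minus inflow at vertex $i$) $=a_i$ for $i\in[n]$. Canonical subdivision: work with multigraphs $H$ on $[n+1]$ whose edges $(r,s)$, $r<s$, carry labels (multisets of edges of $G$), starting from $H=G$ with each edge labelled by itself. A compounded reduction at vertex $i\in\{2,\ldots,n\}$ with incoming edges in $H$: let $I_i$, $O_i$ be the multisets of incoming and outgoing edges at $i$, each linearly ordered; $L=I_i$ if $a_i=0$, else $L=I_i$ followed by a new symbol $v_i$; $R=O_i$. A bipartite noncrossing tree on $(L,R)$ is a spanning tree of the complete bipartite graph on $L\sqcup R$ having no two edges $\{x,y\},\{x',y'\}$ with $x$ before $x'$ in $L$ and $y$ after $y'$ in $R$. $H_T$ is obtained by deleting $I_i\cup O_i$, adding for each tree edge $\{(r,i),(i,s)\}$ an edge $(r,s)$ labelled by the union of labels, for each tree edge $\{v_i,(i,s)\}$ an edge $(i,s)$ with the label of $(i,s)$, and if $a_i=0$ an edge $(i,n+1)$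 with empty label; $\mathcal{F}_{H_T}(\mathbf a)$ is viewed inside $\mathbb{R}^{E(G)}$ by giving each edge $e$ of $G$ the sum of flows on edges whose label contains $e$. The canonical compounded reduction tree applies this at vertices $i=n,n-1,\ldots,2$ in order to all current leaves (leaving $H$ unchanged if $i$ has no incoming edges). Its final leaves (with multiplicity) are graphs $G(\mathbf m)$ consisting of $m_i$ copies of $(i,n+1)$; the polytopes $\mathcal{F}_{G(\mathbf m)}(\mathbf a)$ are the cells of the canonical subdivision, and two cells are of the same type if they come from leaves with the same vector $\mathbf m$. -}

module Defs where

open import Data.Nat using (ℕ; zero; suc; _*_; _∸_; _≡ᵇ_)
open import Data.Nat.Combinatorics using (_C_)
open import Data.Nat.DivMod using (_/_)
open import Data.Bool using (Bool; true; false; if_then_else_; _∨_; not)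
open import Data.Maybe using (Maybe; just; nothing)
open import Data.Fin using (Fin) renaming (_<_ to _<F_)
open import Data.List using (List; []; _∷_; _++_; map; concatMap; length; upTo; lookup; replicate)
open import Data.Product using (Σ; _×_; _,_; proj₁; proj₂; ∃)
open import Data.Sum using (_⊎_; inj₁; inj₂)
open import Data.Vec using (Vec; toList)
open import Data.List.Membership.Propositional using (_∈_)
open import Data.List.Relation.Binary.Permutation.Propositional using (_↭_)
open import Relation.Binary.PropositionalEquality using (_≡_)
open import Relation.Nullary using (¬_)

-- Unlabelled directed multigraphs on vertices 1..N (N = n+1),
-- an edge (r , s) with r < s; a multigraph is a list of edges
-- (the list order is the linear order used on I_i and O_i).

Edge : Set
Edge = ℕ × ℕ

Graph : Set
Graph = List Edge

inSources : Graph → ℕ → List ℕ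
inSources [] i = []
inSources ((r , s) ∷ H) i = if s ≡ᵇ i then r ∷ inSources H i else inSources H i

outTargets : Graph → ℕ → List ℕ
outTargets [] i = []
outTargets ((r , s) ∷ H) i = if r ≡ᵇ i then s ∷ outTargets H i else outTargets H i

dropIncident : Graph → ℕ → Graph
dropIncident [] i = []
dropIncident ((r , s) ∷ H) i =
  if (r ≡ᵇ i) ∨ (s ≡ᵇ i) then dropIncident H i else (r , s) ∷ dropIncident H i

module _ {p q : ℕ} where

  BVert : Set
  BVert = Fin p ⊎ Fin q

  data Adj (T : List (Fin p × Fin q)) : BVert → BVert → Set where
    fwd : ∀ {x y} → (x , y) ∈ T → Adj T (inj₁ x) (inj₂ y)
    bwd : ∀ {x y} → (x , y) ∈ T → Adj T (inj₂ y) (inj₁ x)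

  data Connected (T : List (Fin p × Fin q)) : BVert → BVert → Set where
    here : ∀ {u} → Connected T u u
    step : ∀ {u v w} → Adj T u v → Connected T v w → Connected T u w

  Acyclic : List (Fin p × Fin q) → Set
  Acyclic T = ∀ xs e ys → T ≡ xs ++ e ∷ ys →
    ¬ Connected (xs ++ ys) (inj₁ (proj₁ e)) (inj₂ (proj₂ e))

  SpanningTree : List (Fin p × Fin q) → Set
  SpanningTree T = (∀ u v → Connected T u v) × Acyclic T

  NonCrossing : List (Fin p × Fin q) → Set
  NonCrossing T = ∀ {x y x′ y′} → (x , y) ∈ T → (x′ , y′) ∈ T →
    ¬ ((x <F x′) × (y′ <F y))

-- Compounded reduction at vertex i.
-- Elements of L: just r stands for the incoming edge (r , i),
-- nothing stands for the new symbol v_i.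

Lof : Bool → Graph → ℕ → List (Maybe ℕ)
Lof aiZero H i = map just (inSources H i) ++ (if aiZero then [] else nothing ∷ [])

Rof : Graph → ℕ → List ℕ
Rof H i = outTargets H i

srcOf : ℕ → Maybe ℕ → ℕ
srcOf i (just r) = r
srcOf i nothing = i

treeEdges : (i : ℕ) (L : List (Maybe ℕ)) (R : List ℕ) →
            List (Fin (length L) × Fin (length R)) → Graph
treeEdges i L R T = map (λ xy → srcOf i (lookup L (proj₁ xy)) , lookup R (proj₂ xy)) T

reduceBy : (N : ℕ) (aiZero : Bool) (i : ℕ) (H : Graph) →
           List (Fin (length (Lof aiZero H i)) × Fin (length (Rof H i))) → Graph
reduceBy N aiZero i H T =
  dropIncident H i ++ treeEdges i (Lof aiZero H i) (Rof H i) T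
    ++ (if aiZero then (i , N) ∷ [] else [])

-- one level of the reduction tree at vertex i: H has child H'
data Step (N : ℕ) (aiZero : Bool) (i : ℕ) (H : Graph) : Graph → Set where
  noIncoming : inSources H i ≡ [] → Step N aiZero i H H
  reduce : ¬ (inSources H i ≡ []) →
           (T : List (Fin (length (Lof aiZero H i)) × Fin (length (Rof H i)))) →
           SpanningTree T → NonCrossing T →
           Step N aiZero i H (reduceBy N aiZero i H T)

nthIsZero : List ℕ → ℕ → Bool
nthIsZero [] k = false
nthIsZero (x ∷ xs) zero = x ≡ᵇ 0
nthIsZero (x ∷ xs) (suc k) = nthIsZero xs k

aZero : List ℕ → ℕ → Bool
aZero a i = nthIsZero a (i ∸ 1)

-- Run N a i H H' : H' is a leaf obtained from H by applying the
-- reductions at vertices i, i-1, …, 2 in order.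
data Run (N : ℕ) (a : List ℕ) : ℕ → Graph → Graph → Set where
  done0 : ∀ {H} → Run N a 0 H H
  done1 : ∀ {H} → Run N a 1 H H
  next  : ∀ {i H H′ H″} →
          Step N (aZero a (suc (suc i))) (suc (suc i)) H H′ →
          Run N a (suc i) H′ H″ → Run N a (suc (suc i)) H H″

Pi : ℕ → Graph
Pi n = concatMap (λ i → (i , suc i) ∷ (i , suc n) ∷ []) (map suc (upTo n))

gm : ℕ → ℕ → List ℕ → Graph
gm N i [] = []
gm N i (m ∷ ms) = replicate m (i , N) ++ gm N (suc i) ms

Gm : (n : ℕ) → Vec ℕ n → Graph
Gm n m = gm (suc n) 1 (toList m)

IsCellType : (n : ℕ) → Vec ℕ n → Vec ℕ n → Set
IsCellType n a m = ∃ λ H → Run (suc n) (toList a) n (Pi n) H × (H ↭ Gm n m)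

catalan : ℕ → ℕ
catalan n = ((2 * n) C n) / suc n

{-# OPTIONS --safe #-}
-- When every a_i is positive, the reduction at vertex i of any graph in the canonical reduction
-- tree of Π_n sees on the left the single incoming edge (i-1 , i) followed by v_i, and on the
-- right the c parallel edges (i , n+1).  The noncrossing spanning trees of this K_{2,c} are
-- exactly the c "staircases": for some t < c the incoming edge is joined to the first t+1 right
-- vertices and v_i to the last c-t.  Such a tree turns the graph into one of the same shape one
-- vertex lower, with t+2 parallel edges (i-1 , n+1), and fixes m_i = c-t.  Thus the leaves are
-- indexed by the choices of t, different choices give different vectors m, and their number
-- satisfies the ballot recursion B(k+1, c) = Σ_{t<c} B(k, t+2) started from c = 2 at vertex n.
-- These ballot numbers are differences of binomial coefficients,
-- B(k+1, j+1) = C(2k+j+2, k+1) - C(2k+j+2, k), which for j = 0 is the Catalan number C_{k+1}.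

module Submission where

open import Defs
import Data.Nat as ℕ
open import Data.Nat using (ℕ; zero; suc; _+_; _*_; _∸_; _≤_; _<_; z≤n; s≤s; _<?_; _≤?_; _≡ᵇ_)
open import Data.Nat.Properties
  using ( +-comm; +-assoc; +-identityʳ; *-identityʳ; *-zeroʳ; +-suc; +-cancelʳ-≡; *-comm; *-distribˡ-+; m+n∸n≡m; m≤n+m; m≤m+n
        ; ≤-refl; ≤-trans; ≤-antisym; ≤-reflexive; <-irrefl; <⇒≤; <⇒≢; <⇒≱; ≰⇒>; ≮⇒≥; ≤∧≢⇒<
        ; n≤1+n; m≤n⇒m≤1+n; ∸-cancelˡ-≡; ≡ᵇ⇒≡; ≡⇒≡ᵇ)
open import Data.Nat.Combinatorics using (_C_; nCk+nC[k+1]≡[n+1]C[k+1]; k>n⇒nCk≡0; nCk≡nC[n∸k])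
open import Data.Nat.DivMod using (_/_; m*n/n≡m)
open import Data.Nat.Tactic.RingSolver using (solve-∀)
open import Data.Fin using (Fin; zero; suc; toℕ; fromℕ<)
open import Data.Fin.Properties using (_≟_; toℕ<n; toℕ-injective; toℕ-fromℕ<; suc-injective)
open import Data.Bool using (Bool; true; false; not; if_then_else_; _∨_; T)
open import Data.Bool.Properties using (not-¬; T-≡)
open import Data.Unit using (tt)
open import Data.Maybe using (Maybe; just; nothing)
open import Data.Product using (Σ; ∃; _×_; _,_; proj₁; proj₂)
open import Data.Product.Properties using (,-injectiveʳ)
open import Data.Sum using (_⊎_; inj₁; inj₂)
open import Data.Empty using (⊥-elim)
open import Data.List using (List; []; _∷_; _++_; map; concatMap; length; replicate; upTo; lookup)
open import Data.List.Properties
  using (++-assoc; ++-identityʳ; map-++; map-∘; concatMap-++; upTo-∷ʳ; length-++; length-map; length-replicate)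
open import Data.List.Membership.Propositional using (_∈_; find; lose)
open import Data.List.Membership.Propositional.Properties
  using (∈-++⁺ˡ; ∈-++⁺ʳ; ∈-++⁻; ∈-map⁺; ∈-map⁻; ∈-concatMap⁺; ∈-concatMap⁻; ∈-upTo⁺; ∈-upTo⁻)
open import Data.List.Membership.Propositional.Properties.WithK using (unique∧set⇒bag)
open import Data.List.Relation.Unary.Any using (here; there)
import Data.List.Relation.Unary.All as ListAll
open import Data.List.Relation.Unary.AllPairs using ([]; _∷_)
open import Data.List.Relation.Unary.Unique.Propositional using (Unique)
import Data.List.Relation.Unary.Unique.Propositional.Properties as Unique
open import Data.List.Relation.Binary.BagAndSetEquality using (∼bag⇒↭)
open import Data.List.Relation.Binary.Permutation.Propositional
  using (_↭_; ↭-refl; ↭-sym; ↭-trans; ↭-reflexive; prep; module PermutationReasoning)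
import Data.List.Relation.Binary.Permutation.Propositional as ↭
open import Data.List.Relation.Binary.Permutation.Propositional.Properties
  using (++⁺ˡ; ++⁺ʳ; map⁺; shifts; ∈-resp-↭; ↭-length; ↭-singleton-inv) renaming (++-comm to ↭-++-comm)
open import Data.Vec using (Vec; []; _∷_; _∷ʳ_; toList)
open import Data.Vec.Properties using (∷ʳ-injectiveˡ; ∷ʳ-injectiveʳ; toList-∷ʳ)
open import Data.Vec.Relation.Unary.All using (All; []; _∷_)
open import Function using (_∘_)
open import Function.Bundles using (mk⇔; Equivalence)
open import Relation.Nullary using (¬_; yes; no; does; contradiction)
open import Relation.Nullary.Decidable using (dec-true; dec-false)
open import Relation.Binary.PropositionalEquality

-- Binomial coefficients and ballot numbers

binomial : ℕ → ℕ → ℕ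
binomial n       zero    = 1
binomial zero    (suc k) = 0
binomial (suc n) (suc k) = binomial n k + binomial n (suc k)

binomial≡C : ∀ n k → binomial n k ≡ n C k
binomial≡C n       zero    = refl
binomial≡C zero    (suc k) = sym (k>n⇒nCk≡0 {0} {suc k} (s≤s z≤n))
binomial≡C (suc n) (suc k) =
  trans (cong₂ _+_ (binomial≡C n k) (binomial≡C n (suc k))) (nCk+nC[k+1]≡[n+1]C[k+1] n k)

binomial-sym : ∀ {n k} → k ≤ n → binomial n k ≡ binomial n (n ∸ k)
binomial-sym {n} {k} k≤n =
  trans (binomial≡C n k) (trans (nCk≡nC[n∸k] k≤n) (sym (binomial≡C n (n ∸ k))))

binomial-1 : ∀ n → binomial n 1 ≡ n
binomial-1 zero    = refl
binomial-1 (suc n) = cong suc (binomial-1 n)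

binomial-absorb : ∀ m j → suc j * binomial m (suc j) + j * binomial m j ≡ m * binomial m j
binomial-absorb zero    zero    = refl
binomial-absorb zero    (suc j) = cong₂ _+_ (*-zeroʳ (suc (suc j))) (*-zeroʳ (suc j))
binomial-absorb (suc m) zero    =
  cong suc (trans (+-identityʳ _) (trans (+-identityʳ _) (trans (binomial-1 m) (sym (*-identityʳ m)))))
binomial-absorb (suc m) (suc j) = begin
  suc (suc j) * (y + z) + suc j * (x + y)
    ≡⟨ split j x y z ⟩
  (suc (suc j) * z + suc j * y) + (suc j * y + j * x) + (x + y)
    ≡⟨ cong₂ (λ a b → a + b + (x + y)) (binomial-absorb m (suc j)) (binomial-absorb m j) ⟩
  m * y + m * x + (x + y)
    ≡⟨ collect m x y ⟩
  suc m * (x + y) ∎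
  where
  open ≡-Reasoning
  x : ℕ
  x = binomial m j
  y : ℕ
  y = binomial m (suc j)
  z : ℕ
  z = binomial m (suc (suc j))
  split : ∀ j x y z → suc (suc j) * (y + z) + suc j * (x + y) ≡
                      (suc (suc j) * z + suc j * y) + (suc j * y + j * x) + (x + y)
  split = solve-∀
  collect : ∀ m x y → m * y + m * x + (x + y) ≡ suc m * (x + y)
  collect = solve-∀

ballot : ℕ → ℕ → ℕ
ballot zero    c       = 1
ballot (suc k) zero    = 0
ballot (suc k) (suc c) = ballot (suc k) c + ballot k (2 + c)

ballot-1 : ∀ c → ballot 1 c ≡ c
ballot-1 zero    = refl
ballot-1 (suc c) = trans (cong (_+ 1) (ballot-1 c)) (+-comm c 1)

row : ℕ → ℕ → ℕ
row k j = 2 + (k + k + j)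

row-sucʳ : ∀ k j → row k (suc j) ≡ suc (row k j)
row-sucʳ k j = cong (2 +_) (+-suc (k + k) j)

row-sucˡ : ∀ k j → row (suc k) j ≡ row k (2 + j)
row-sucˡ k j = cong (2 +_) (arith k j)
  where
  arith : ∀ k j → suc k + suc k + j ≡ k + k + (2 + j)
  arith = solve-∀

ballot-binomial : ∀ k j → ballot (suc k) (suc j) + binomial (row k j) k ≡ binomial (row k j) (suc k)
ballot-binomial zero j = begin
  ballot 1 (suc j) + 1 ≡⟨ cong (_+ 1) (ballot-1 (suc j)) ⟩
  suc j + 1            ≡⟨ +-comm (suc j) 1 ⟩
  2 + j                ≡⟨ binomial-1 (2 + j) ⟨
  binomial (2 + j) 1   ∎
  where open ≡-Reasoning
ballot-binomial (suc k) zero = begin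
  g + binomial (row (suc k) 0) (suc k)            ≡⟨ cong (λ m → g + binomial m (suc k)) row≡1+M ⟩
  g + (binomial M k + binomial M (suc k))         ≡⟨ +-assoc g _ _ ⟨
  g + binomial M k + binomial M (suc k)           ≡⟨ cong (_+ binomial M (suc k)) (ballot-binomial k 1) ⟩
  binomial M (suc k) + binomial M (suc k)         ≡⟨ cong (binomial M (suc k) +_) central ⟩
  binomial (suc M) (2 + k)                        ≡⟨ cong (λ m → binomial m (2 + k)) row≡1+M ⟨
  binomial (row (suc k) 0) (2 + k)                ∎
  where
  open ≡-Reasoning
  g : ℕ
  g = ballot (suc k) 2
  M : ℕ
  M = row k 1
  row≡1+M : row (suc k) 0 ≡ suc M
  row≡1+M = trans (row-sucˡ k 0) (row-sucʳ k 1)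
  M≡[2+k]+[1+k] : M ≡ (2 + k) + suc k
  M≡[2+k]+[1+k] = cong (2 +_) (trans (+-suc (k + k) 0) (trans (cong suc (+-identityʳ (k + k))) (sym (+-suc k k))))
  central : binomial M (suc k) ≡ binomial M (2 + k)
  central = begin
    binomial M (suc k)       ≡⟨ binomial-sym (subst (suc k ≤_) (sym M≡[2+k]+[1+k]) (m≤n+m (suc k) (2 + k))) ⟩
    binomial M (M ∸ suc k)   ≡⟨ cong (binomial M) (trans (cong (_∸ suc k) M≡[2+k]+[1+k]) (m+n∸n≡m (2 + k) (suc k))) ⟩
    binomial M (2 + k)       ∎
ballot-binomial (suc k) (suc j) = begin
  (g₁ + g₂) + binomial (row (suc k) (suc j)) (suc k) ≡⟨ cong (λ m → g₁ + g₂ + binomial m (suc k)) (row-sucʳ (suc k) j) ⟩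
  (g₁ + g₂) + (binomial M k + binomial M (suc k))     ≡⟨ +-interchange g₁ g₂ _ _ ⟩
  (g₁ + binomial M (suc k)) + (g₂ + binomial M k)     ≡⟨ cong₂ _+_ (ballot-binomial (suc k) j) IH₂ ⟩
  binomial M (2 + k) + binomial M (suc k)            ≡⟨ +-comm (binomial M (2 + k)) _ ⟩
  binomial (suc M) (2 + k)                            ≡⟨ cong (λ m → binomial m (2 + k)) (row-sucʳ (suc k) j) ⟨
  binomial (row (suc k) (suc j)) (2 + k)              ∎
  where
  open ≡-Reasoning
  g₁ : ℕ
  g₁ = ballot (2 + k) (suc j)
  g₂ : ℕ
  g₂ = ballot (suc k) (3 + j)
  M : ℕ
  M = row (suc k) j
  IH₂ : g₂ + binomial M k ≡ binomial M (suc k)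
  IH₂ = subst (λ m → g₂ + binomial m k ≡ binomial m (suc k)) (sym (row-sucˡ k j)) (ballot-binomial k (2 + j))
  +-interchange : ∀ a b c d → (a + b) + (c + d) ≡ (a + d) + (b + c)
  +-interchange = solve-∀

catalan≡ballot : ∀ k → catalan (suc k) ≡ ballot (suc k) 1
catalan≡ballot k = begin
  ((2 * suc k) C suc k) / (2 + k) ≡⟨ cong (λ m → (m C suc k) / (2 + k)) 2[1+k]≡M ⟩
  (M C suc k) / (2 + k)           ≡⟨ cong (_/ (2 + k)) (binomial≡C M (suc k)) ⟨
  y / (2 + k)                      ≡⟨ cong (_/ (2 + k)) [2+k]G≡y ⟨
  ((2 + k) * G) / (2 + k)          ≡⟨ cong (_/ (2 + k)) (*-comm (2 + k) G) ⟩
  (G * (2 + k)) / (2 + k)          ≡⟨ m*n/n≡m G (2 + k) ⟩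
  G                                ∎
  where
  open ≡-Reasoning
  M : ℕ
  M = row k 0
  G : ℕ
  G = ballot (suc k) 1
  x : ℕ
  x = binomial M k
  y : ℕ
  y = binomial M (suc k)
  2[1+k]≡M : 2 * suc k ≡ M
  2[1+k]≡M = arith k
    where
    arith : ∀ k → 2 * suc k ≡ 2 + (k + k + 0)
    arith = solve-∀
  [1+k]y≡[2+k]x : suc k * y ≡ (2 + k) * x
  [1+k]y≡[2+k]x = +-cancelʳ-≡ (k * x) _ _ (begin
    suc k * y + k * x     ≡⟨ binomial-absorb M k ⟩
    M * x                 ≡⟨ arith k x ⟩
    (2 + k) * x + k * x   ∎)
    where
    arith : ∀ k x → (2 + (k + k + 0)) * x ≡ (2 + k) * x + k * x
    arith = solve-∀
  [2+k]G≡y : (2 + k) * G ≡ y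
  [2+k]G≡y = +-cancelʳ-≡ ((2 + k) * x) _ _ (begin
    (2 + k) * G + (2 + k) * x ≡⟨ *-distribˡ-+ (2 + k) G x ⟨
    (2 + k) * (G + x)         ≡⟨ cong ((2 + k) *_) (ballot-binomial k 0) ⟩
    (2 + k) * y               ≡⟨⟩
    y + suc k * y             ≡⟨ cong (y +_) [1+k]y≡[2+k]x ⟩
    y + (2 + k) * x           ∎)

removed-unique : ∀ {A : Set} {xs ys : List A} {e e′} → Unique (xs ++ e ∷ ys) → e′ ∈ xs ++ ys → e′ ≢ e
removed-unique {xs = []}     (e∉ys ∷ _)  e′∈ys           refl = ListAll.lookup e∉ys e′∈ys refl
removed-unique {xs = x ∷ xs} (x∉ ∷ _)    (here refl)      refl = ListAll.lookup x∉ (∈-++⁺ʳ xs (here refl)) refl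
removed-unique {xs = x ∷ xs} (_ ∷ u)     (there e′∈)      = removed-unique u e′∈

∈-insert-middle : ∀ {A : Set} (xs : List A) {ys e e′} → e′ ∈ xs ++ ys → e′ ∈ xs ++ e ∷ ys
∈-insert-middle xs e′∈ with ∈-++⁻ xs e′∈
... | inj₁ e′∈xs = ∈-++⁺ˡ e′∈xs
... | inj₂ e′∈ys = ∈-++⁺ʳ xs (there e′∈ys)

concatMap-↭ : ∀ {A B : Set} (f : A → List B) {xs ys} → xs ↭ ys → concatMap f xs ↭ concatMap f ys
concatMap-↭ f ↭.refl          = ↭-refl
concatMap-↭ f (↭.prep x p)    = ++⁺ˡ (f x) (concatMap-↭ f p)
concatMap-↭ f (↭.swap x y p)  = ↭-trans (shifts (f x) (f y)) (++⁺ˡ (f y) (++⁺ˡ (f x) (concatMap-↭ f p)))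
concatMap-↭ f (↭.trans p p′)  = ↭-trans (concatMap-↭ f p) (concatMap-↭ f p′)

∈-replicate⁻ : ∀ {A : Set} {x y : A} c → y ∈ replicate c x → y ≡ x
∈-replicate⁻ (suc c) (here y≡x) = y≡x
∈-replicate⁻ (suc c) (there y∈) = ∈-replicate⁻ c y∈

↭-replicate-inv : ∀ {A : Set} {xs : List A} {x} c → xs ↭ replicate c x → xs ≡ replicate c x
↭-replicate-inv {xs = xs} {x} c xs↭ = trans (all-x xs (λ y∈ → ∈-replicate⁻ c (∈-resp-↭ xs↭ y∈)))
  (cong (λ m → replicate m x) (trans (↭-length xs↭) (length-replicate c)))
  where
  all-x : ∀ ys → (∀ {y} → y ∈ ys → y ≡ x) → ys ≡ replicate (length ys) x
  all-x []       _    = refl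
  all-x (y ∷ ys) ys≡x = cong₂ _∷_ (ys≡x (here refl)) (all-x ys (ys≡x ∘ there))

map-const : ∀ {A B : Set} {f : A → B} {x} → (∀ a → f a ≡ x) → ∀ as → map f as ≡ replicate (length as) x
map-const f≡x []       = refl
map-const f≡x (a ∷ as) = cong₂ _∷_ (f≡x a) (map-const f≡x as)

lookup-replicate′ : ∀ {A : Set} c (x : A) (y : Fin (length (replicate c x))) → lookup (replicate c x) y ≡ x
lookup-replicate′ (suc c) x zero    = refl
lookup-replicate′ (suc c) x (suc y) = lookup-replicate′ c x y

length-concatMap-map : ∀ {A B C : Set} (g : A → B → C) (h : A → List B) xs →
  length (concatMap (λ x → map (g x) (h x)) xs) ≡ length (concatMap h xs)
length-concatMap-map g h []       = refl
length-concatMap-map g h (x ∷ xs) = begin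
  length (map (g x) (h x) ++ concatMap (λ x → map (g x) (h x)) xs)
    ≡⟨ length-++ (map (g x) (h x)) ⟩
  length (map (g x) (h x)) + length (concatMap (λ x → map (g x) (h x)) xs)
    ≡⟨ cong₂ _+_ (length-map (g x) (h x)) (length-concatMap-map g h xs) ⟩
  length (h x) + length (concatMap h xs)
    ≡⟨ length-++ (h x) ⟨
  length (h x ++ concatMap h xs) ∎
  where open ≡-Reasoning

concatMap-unique : ∀ {A B : Set} (f : A → List B) {xs} → Unique xs → (∀ x → Unique (f x)) →
  (∀ {x x′ y} → x ∈ xs → x′ ∈ xs → y ∈ f x → y ∈ f x′ → x ≡ x′) → Unique (concatMap f xs)
concatMap-unique f {[]}     _            _        _        = []
concatMap-unique f {x ∷ xs} (x∉xs ∷ xs!) f-unique disjoint =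
  Unique.++⁺ (f-unique x) (concatMap-unique f xs! f-unique (λ x∈ x′∈ → disjoint (there x∈) (there x′∈)))
    λ (y∈fx , y∈rest) → let x′ , x′∈xs , y∈fx′ = find (∈-concatMap⁻ f y∈rest) in
      ListAll.lookup x∉xs x′∈xs (disjoint (here refl) (there x′∈xs) y∈fx y∈fx′)

-- Spanning trees of complete bipartite graphs

module _ {p q : ℕ} {T : List (Fin p × Fin q)} where

  Adj-sym : ∀ {u v} → Adj T u v → Adj T v u
  Adj-sym (fwd e∈T) = bwd e∈T
  Adj-sym (bwd e∈T) = fwd e∈T

  Connected-trans : ∀ {u v w} → Connected T u v → Connected T v w → Connected T u w
  Connected-trans here        c = c
  Connected-trans (step a u~v) c = step a (Connected-trans u~v c)

  Connected-sym : ∀ {u v} → Connected T u v → Connected T v u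
  Connected-sym here         = here
  Connected-sym (step a u~v) = Connected-trans (Connected-sym u~v) (step (Adj-sym a) here)

  Connected-mono : ∀ {T′} → (∀ {e} → e ∈ T → e ∈ T′) → ∀ {u v} → Connected T u v → Connected T′ u v
  Connected-mono T⊆T′ here                = here
  Connected-mono T⊆T′ (step (fwd e∈T) c) = step (fwd (T⊆T′ e∈T)) (Connected-mono T⊆T′ c)
  Connected-mono T⊆T′ (step (bwd e∈T) c) = step (bwd (T⊆T′ e∈T)) (Connected-mono T⊆T′ c)

  Connected⇒≡colour : (colour : BVert {p} {q} → Bool) →
    (∀ {x y} → (x , y) ∈ T → colour (inj₁ x) ≡ colour (inj₂ y)) →
    ∀ {u v} → Connected T u v → colour u ≡ colour v
  Connected⇒≡colour colour monochromatic here                = refl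
  Connected⇒≡colour colour monochromatic (step (fwd e∈T) c) = trans (monochromatic e∈T) (Connected⇒≡colour colour monochromatic c)
  Connected⇒≡colour colour monochromatic (step (bwd e∈T) c) = trans (sym (monochromatic e∈T)) (Connected⇒≡colour colour monochromatic c)

acyclic⇒unique : ∀ {p q} {T : List (Fin p × Fin q)} → Acyclic T → Unique T
acyclic⇒unique {T = []}     acyclic = []
acyclic⇒unique {T = e ∷ T} acyclic = ListAll.tabulate e∉T ∷ acyclic⇒unique acyclic-T
  where
  e∉T : ∀ {e′} → e′ ∈ T → e ≢ e′
  e∉T e′∈T refl = acyclic [] e T refl (step (fwd e′∈T) here)
  acyclic-T : Acyclic T
  acyclic-T xs e′ ys refl c =
    acyclic (e ∷ xs) e′ ys refl (Connected-mono there c)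

atMost : (q t : ℕ) → List (Fin q)
atMost zero    t       = []
atMost (suc q) zero    = zero ∷ []
atMost (suc q) (suc t) = zero ∷ map suc (atMost q t)

atLeast : (q t : ℕ) → List (Fin q)
atLeast zero    t       = []
atLeast (suc q) zero    = zero ∷ map suc (atLeast q zero)
atLeast (suc q) (suc t) = map suc (atLeast q t)

∈-atMost⁺ : ∀ {q t} (y : Fin q) → toℕ y ≤ t → y ∈ atMost q t
∈-atMost⁺ {suc q} {zero}  zero    _         = here refl
∈-atMost⁺ {suc q} {suc t} zero    _         = here refl
∈-atMost⁺ {suc q} {suc t} (suc y) (s≤s y≤t) = there (∈-map⁺ suc (∈-atMost⁺ y y≤t))

∈-atMost⁻ : ∀ {q t} (y : Fin q) → y ∈ atMost q t → toℕ y ≤ t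
∈-atMost⁻ {suc q} {zero}  zero    _           = z≤n
∈-atMost⁻ {suc q} {zero}  (suc y) (here ())
∈-atMost⁻ {suc q} {zero}  (suc y) (there ())
∈-atMost⁻ {suc q} {suc t} zero    _           = z≤n
∈-atMost⁻ {suc q} {suc t} (suc y) (there y∈) with ∈-map⁻ suc y∈
... | y′ , y′∈ , refl = s≤s (∈-atMost⁻ y′ y′∈)

∈-atLeast⁺ : ∀ {q t} (y : Fin q) → t ≤ toℕ y → y ∈ atLeast q t
∈-atLeast⁺ {suc q} {zero}  zero    _         = here refl
∈-atLeast⁺ {suc q} {zero}  (suc y) _         = there (∈-map⁺ suc (∈-atLeast⁺ y z≤n))
∈-atLeast⁺ {suc q} {suc t} (suc y) (s≤s t≤y) = ∈-map⁺ suc (∈-atLeast⁺ y t≤y)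

∈-atLeast⁻ : ∀ {q t} (y : Fin q) → y ∈ atLeast q t → t ≤ toℕ y
∈-atLeast⁻ {suc q} {zero}  y _ = z≤n
∈-atLeast⁻ {suc q} {suc t} y y∈ with ∈-map⁻ suc y∈
... | y′ , y′∈ , refl = s≤s (∈-atLeast⁻ y′ y′∈)

length-atMost : ∀ {q t} → t < q → length (atMost q t) ≡ suc t
length-atMost {suc q} {zero}  _         = refl
length-atMost {suc q} {suc t} (s≤s t<q) = cong suc (trans (length-map suc (atMost q t)) (length-atMost t<q))

length-atLeast : ∀ q t → length (atLeast q t) ≡ q ∸ t
length-atLeast zero    zero    = refl
length-atLeast zero    (suc t) = refl
length-atLeast (suc q) zero    = cong suc (trans (length-map suc (atLeast q zero)) (length-atLeast q zero))
length-atLeast (suc q) (suc t) = trans (length-map suc (atLeast q t)) (length-atLeast q t)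

private
  zero∷map-suc-unique : ∀ {q} {ys : List (Fin q)} → Unique ys → Unique (zero ∷ map suc ys)
  zero∷map-suc-unique {ys = ys} u = ListAll.tabulate zero∉ ∷ Unique.map⁺ suc-injective u
    where
    zero∉ : ∀ {y} → y ∈ map suc ys → zero ≢ y
    zero∉ y∈ refl with ∈-map⁻ suc y∈
    ... | _ , _ , ()

atMost-unique : ∀ q t → Unique (atMost q t)
atMost-unique zero    t       = []
atMost-unique (suc q) zero    = (ListAll.tabulate λ ()) ∷ []
atMost-unique (suc q) (suc t) = zero∷map-suc-unique (atMost-unique q t)

atLeast-unique : ∀ q t → Unique (atLeast q t)
atLeast-unique zero    t       = []
atLeast-unique (suc q) zero    = zero∷map-suc-unique (atLeast-unique q zero)
atLeast-unique (suc q) (suc t) = Unique.map⁺ suc-injective (atLeast-unique q t)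

staircase : ∀ {q} → ℕ → List (Fin 2 × Fin q)
staircase {q} t = map (zero ,_) (atMost q t) ++ map (suc zero ,_) (atLeast q t)

module _ {q t : ℕ} where

  ∈-staircase⁻ : ∀ {x} {y : Fin q} → (x , y) ∈ staircase t →
                 (x ≡ zero × toℕ y ≤ t) ⊎ (x ≡ suc zero × t ≤ toℕ y)
  ∈-staircase⁻ e∈ with ∈-++⁻ (map (zero ,_) (atMost q t)) e∈
  ... | inj₁ e∈ˡ with ∈-map⁻ (zero ,_) e∈ˡ
  ...   | y , y∈ , refl = inj₁ (refl , ∈-atMost⁻ y y∈)
  ∈-staircase⁻ e∈ | inj₂ e∈ʳ with ∈-map⁻ (suc zero ,_) e∈ʳ
  ...   | y , y∈ , refl = inj₂ (refl , ∈-atLeast⁻ y y∈)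

  ∈-staircaseˡ : {y : Fin q} → toℕ y ≤ t → (zero , y) ∈ staircase t
  ∈-staircaseˡ y≤t = ∈-++⁺ˡ (∈-map⁺ (zero ,_) (∈-atMost⁺ _ y≤t))

  ∈-staircaseʳ : {y : Fin q} → t ≤ toℕ y → (suc zero , y) ∈ staircase t
  ∈-staircaseʳ t≤y = ∈-++⁺ʳ (map (zero ,_) (atMost q t)) (∈-map⁺ (suc zero ,_) (∈-atLeast⁺ _ t≤y))

  staircase-unique : Unique (staircase {q} t)
  staircase-unique = Unique.++⁺ (Unique.map⁺ ,-injectiveʳ (atMost-unique q t))
                                (Unique.map⁺ ,-injectiveʳ (atLeast-unique q t)) disjoint
    where
    disjoint : ∀ {e} → ¬ (e ∈ map (zero ,_) (atMost q t) × e ∈ map (suc zero ,_) (atLeast q t))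
    disjoint (e∈ˡ , e∈ʳ) with ∈-map⁻ (zero ,_) e∈ˡ | ∈-map⁻ (suc zero ,_) e∈ʳ
    ... | _ , _ , refl | _ , _ , ()

  staircase-nonCrossing : NonCrossing (staircase {q} t)
  staircase-nonCrossing e∈ e′∈ (x<x′ , y′<y) with ∈-staircase⁻ e∈ | ∈-staircase⁻ e′∈
  ... | inj₁ (refl , y≤t) | inj₂ (refl , t≤y′) = <⇒≱ y′<y (≤-trans y≤t t≤y′)
  ... | inj₁ (refl , _)   | inj₁ (refl , _)    = <-irrefl refl x<x′
  ... | inj₂ (refl , _)   | inj₂ (refl , _)    = <-irrefl refl x<x′
  ... | inj₂ (refl , _)   | inj₁ (refl , _)    = <⇒≱ x<x′ z≤n

  staircase-leaf : ∀ {x x′} {y : Fin q} → (x , y) ∈ staircase t → (x′ , y) ∈ staircase t →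
                   toℕ y ≢ t → x ≡ x′
  staircase-leaf e∈ e′∈ y≢t with ∈-staircase⁻ e∈ | ∈-staircase⁻ e′∈
  ... | inj₁ (refl , _)   | inj₁ (refl , _)    = refl
  ... | inj₂ (refl , _)   | inj₂ (refl , _)    = refl
  ... | inj₁ (refl , y≤t) | inj₂ (refl , t≤y)  = ⊥-elim (y≢t (≤-antisym y≤t t≤y))
  ... | inj₂ (refl , t≤y) | inj₁ (refl , y≤t)  = ⊥-elim (y≢t (≤-antisym y≤t t≤y))

  staircase-connected : t < q → ∀ u v → Connected (staircase {q} t) u v
  staircase-connected t<q u v = Connected-trans (to-hub u) (Connected-sym (to-hub v))
    where
    hub : Fin q
    hub = fromℕ< t<q
    to-hub : ∀ u → Connected (staircase t) u (inj₂ hub)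
    to-hub (inj₁ zero)       = step (fwd (∈-staircaseˡ (≤-reflexive (toℕ-fromℕ< t<q)))) here
    to-hub (inj₁ (suc zero)) = step (fwd (∈-staircaseʳ (≤-reflexive (sym (toℕ-fromℕ< t<q))))) here
    to-hub (inj₂ y) with toℕ y ≤? t
    ... | yes y≤t = step (bwd (∈-staircaseˡ y≤t)) (to-hub (inj₁ zero))
    ... | no  y≰t = step (bwd (∈-staircaseʳ (<⇒≤ (≰⇒> y≰t)))) (to-hub (inj₁ (suc zero)))

  -- Deleting an edge (x₀ , y₀) of a staircase disconnects its endpoints: in each case a colouring
  -- that is constant along every remaining edge gives x₀ and y₀ different colours.
  private
    module EdgeRemoved (xs ys : List (Fin 2 × Fin q)) {x₀ y₀} (eq : staircase t ≡ xs ++ (x₀ , y₀) ∷ ys) where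

      removed : (x₀ , y₀) ∈ staircase t
      removed = subst ((x₀ , y₀) ∈_) (sym eq) (∈-++⁺ʳ xs (here refl))

      kept : ∀ {e} → e ∈ xs ++ ys → e ∈ staircase t
      kept e∈ = subst (_ ∈_) (sym eq) (∈-insert-middle xs e∈)

      other : ∀ {e} → e ∈ xs ++ ys → e ≢ (x₀ , y₀)
      other = removed-unique (subst Unique eq staircase-unique)

      separated : (colour : BVert {2} {q} → Bool) →
                  (∀ {x y} → (x , y) ∈ xs ++ ys → colour (inj₁ x) ≡ colour (inj₂ y)) →
                  ∀ {b} → colour (inj₁ x₀) ≡ b → colour (inj₂ y₀) ≡ not b →
                  ¬ Connected (xs ++ ys) (inj₁ x₀) (inj₂ y₀)
      separated colour monochromatic x₀↦b y₀↦¬b c =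
        not-¬ refl (trans (sym x₀↦b) (trans (Connected⇒≡colour colour monochromatic c) y₀↦¬b))

      leaf-removed : toℕ y₀ ≢ t → ¬ Connected (xs ++ ys) (inj₁ x₀) (inj₂ y₀)
      leaf-removed y₀≢t = separated colour monochromatic refl (dec-true (y₀ ≟ y₀) refl)
        where
        colour : BVert → Bool
        colour (inj₁ _) = false
        colour (inj₂ y) = does (y ≟ y₀)
        monochromatic : ∀ {x y} → (x , y) ∈ xs ++ ys → false ≡ does (y ≟ y₀)
        monochromatic {y = y} e∈ = sym (dec-false (y ≟ y₀) λ { refl →
          other e∈ (cong (_, y₀) (staircase-leaf (kept e∈) removed y₀≢t)) })

      lower-hub-removed : x₀ ≡ zero → toℕ y₀ ≡ t → ¬ Connected (xs ++ ys) (inj₁ x₀) (inj₂ y₀)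
      lower-hub-removed refl y₀≡t =
        separated colour monochromatic (dec-true (zero {1} ≟ zero) refl) (dec-false (toℕ y₀ <? t) (<-irrefl y₀≡t))
        where
        colour : BVert → Bool
        colour (inj₁ x) = does (x ≟ zero)
        colour (inj₂ y) = does (toℕ y <? t)
        monochromatic : ∀ {x y} → (x , y) ∈ xs ++ ys → colour (inj₁ x) ≡ colour (inj₂ y)
        monochromatic {y = y} e∈ with ∈-staircase⁻ (kept e∈)
        ... | inj₁ (refl , y≤t) =
          trans (dec-true (zero {1} ≟ zero) refl) (sym (dec-true (toℕ y <? t) (≤∧≢⇒< y≤t y≢t)))
          where
          y≢t : toℕ y ≢ t
          y≢t y≡t = other e∈ (cong (zero ,_) (toℕ-injective (trans y≡t (sym y₀≡t))))
        ... | inj₂ (refl , t≤y) =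
          trans (dec-false (suc {1} zero ≟ zero) λ ()) (sym (dec-false (toℕ y <? t) (λ y<t → <⇒≱ y<t t≤y)))

      upper-hub-removed : x₀ ≡ suc zero → toℕ y₀ ≡ t → ¬ Connected (xs ++ ys) (inj₁ x₀) (inj₂ y₀)
      upper-hub-removed refl y₀≡t =
        separated colour monochromatic (dec-true (suc {1} zero ≟ suc zero) refl) (dec-false (t <? toℕ y₀) (<-irrefl (sym y₀≡t)))
        where
        colour : BVert → Bool
        colour (inj₁ x) = does (x ≟ suc zero)
        colour (inj₂ y) = does (t <? toℕ y)
        monochromatic : ∀ {x y} → (x , y) ∈ xs ++ ys → colour (inj₁ x) ≡ colour (inj₂ y)
        monochromatic {y = y} e∈ with ∈-staircase⁻ (kept e∈)
        ... | inj₂ (refl , t≤y) =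
          trans (dec-true (suc {1} zero ≟ suc zero) refl) (sym (dec-true (t <? toℕ y) (≤∧≢⇒< t≤y t≢y)))
          where
          t≢y : t ≢ toℕ y
          t≢y t≡y = other e∈ (cong (suc zero ,_) (toℕ-injective (trans (sym t≡y) (sym y₀≡t))))
        ... | inj₁ (refl , y≤t) =
          trans (dec-false (zero {1} ≟ suc zero) λ ()) (sym (dec-false (t <? toℕ y) (λ t<y → <⇒≱ t<y y≤t)))

      disconnected : ¬ Connected (xs ++ ys) (inj₁ x₀) (inj₂ y₀)
      disconnected with toℕ y₀ ℕ.≟ t | ∈-staircase⁻ removed
      ... | no  y₀≢t | _               = leaf-removed y₀≢t
      ... | yes y₀≡t | inj₁ (x₀≡0 , _) = lower-hub-removed x₀≡0 y₀≡t
      ... | yes y₀≡t | inj₂ (x₀≡1 , _) = upper-hub-removed x₀≡1 y₀≡t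

  staircase-acyclic : Acyclic (staircase {q} t)
  staircase-acyclic xs _ ys = EdgeRemoved.disconnected xs ys

  staircase-spanningTree : t < q → SpanningTree (staircase {q} t)
  staircase-spanningTree t<q = staircase-connected t<q , staircase-acyclic

module _ {q : ℕ} {T : List (Fin 2 × Fin q)} where

  private
    Reaches : BVert {2} {q} → Set
    Reaches (inj₁ x) = x ≡ zero
    Reaches (inj₂ y) = (zero , y) ∈ T

    walk : ∀ {u} → Reaches u → Connected T u (inj₁ (suc zero)) →
           ∃ λ y → (zero , y) ∈ T × (suc zero , y) ∈ T
    walk refl (step (fwd e∈) c)              = walk e∈ c
    walk _    (step (bwd {zero} e∈) c)       = walk refl c
    walk r    (step (bwd {suc zero} {y} e∈) c) = y , r , e∈

  common-neighbour : Connected T (inj₁ zero) (inj₁ (suc zero)) →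
                     ∃ λ y → (zero , y) ∈ T × (suc zero , y) ∈ T
  common-neighbour = walk refl

  neighbour : ∀ y → Connected T (inj₂ y) (inj₁ zero) → (zero , y) ∈ T ⊎ (suc zero , y) ∈ T
  neighbour y (step (bwd {zero} e∈) _)      = inj₁ e∈
  neighbour y (step (bwd {suc zero} e∈) _)  = inj₂ e∈

nonCrossingTree⇒staircase : ∀ {q} {T : List (Fin 2 × Fin q)} → SpanningTree T → NonCrossing T →
                            ∃ λ t → t < q × T ↭ staircase t
nonCrossingTree⇒staircase {q} {T} (connected , acyclic) nonCrossing =
  toℕ y* , toℕ<n y* ,
  ∼bag⇒↭ (unique∧set⇒bag (acyclic⇒unique acyclic) staircase-unique (mk⇔ to from))
  where
  shared : ∃ λ y → (zero , y) ∈ T × (suc zero , y) ∈ T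
  shared = common-neighbour (connected (inj₁ zero) (inj₁ (suc zero)))
  y* : Fin q
  y* = proj₁ shared
  zero-y* : (zero , y*) ∈ T
  zero-y* = proj₁ (proj₂ shared)
  one-y* : (suc zero , y*) ∈ T
  one-y* = proj₂ (proj₂ shared)
  ordered : ∀ {y y′} → (zero , y) ∈ T → (suc zero , y′) ∈ T → toℕ y ≤ toℕ y′
  ordered e∈ e′∈ = ≮⇒≥ (λ y′<y → nonCrossing e∈ e′∈ (s≤s z≤n , y′<y))
  to : ∀ {e} → e ∈ T → e ∈ staircase (toℕ y*)
  to {zero     , y} e∈ = ∈-staircaseˡ (ordered e∈ one-y*)
  to {suc zero , y} e∈ = ∈-staircaseʳ (ordered zero-y* e∈)
  from : ∀ {e} → e ∈ staircase (toℕ y*) → e ∈ T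
  from {x , y} e∈ with ∈-staircase⁻ e∈ | neighbour y (connected (inj₂ y) (inj₁ zero))
  ... | inj₁ (refl , _)   | inj₁ e∈T  = e∈T
  ... | inj₁ (refl , y≤t) | inj₂ e′∈T = subst (λ y → (zero , y) ∈ T) (toℕ-injective (≤-antisym (ordered zero-y* e′∈T) y≤t)) zero-y*
  ... | inj₂ (refl , _)   | inj₂ e∈T  = e∈T
  ... | inj₂ (refl , t≤y) | inj₁ e′∈T = subst (λ y → (suc zero , y) ∈ T) (toℕ-injective (≤-antisym t≤y (ordered e′∈T one-y*))) one-y*

≡ᵇ-refl : ∀ m → (m ≡ᵇ m) ≡ true
≡ᵇ-refl m = Equivalence.to T-≡ (≡⇒≡ᵇ m m refl)

≢⇒≡ᵇ≡false : ∀ {m n} → m ≢ n → (m ≡ᵇ n) ≡ false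
≢⇒≡ᵇ≡false {m} {n} m≢n with m ≡ᵇ n in eq
... | false = refl
... | true  = contradiction (≡ᵇ⇒≡ m n (subst T (sym eq) tt)) m≢n

module _ {A B : Set} {F : List A → List B} {f : A → List B} (F≗ : ∀ xs → F xs ≡ concatMap f xs) where

  concatMap-like-++ : ∀ xs ys → F (xs ++ ys) ≡ F xs ++ F ys
  concatMap-like-++ xs ys =
    trans (F≗ (xs ++ ys)) (trans (concatMap-++ f xs ys) (sym (cong₂ _++_ (F≗ xs) (F≗ ys))))

  concatMap-like-↭ : ∀ {xs ys} → xs ↭ ys → F xs ↭ F ys
  concatMap-like-↭ {xs} {ys} p =
    subst₂ _↭_ (sym (F≗ xs)) (sym (F≗ ys)) (concatMap-↭ f p)

inSources≗concatMap : ∀ i H → inSources H i ≡ concatMap (λ (r , s) → if s ≡ᵇ i then r ∷ [] else []) H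
inSources≗concatMap i []            = refl
inSources≗concatMap i ((r , s) ∷ H) with s ≡ᵇ i
... | true  = cong (r ∷_) (inSources≗concatMap i H)
... | false = inSources≗concatMap i H

outTargets≗concatMap : ∀ i H → outTargets H i ≡ concatMap (λ (r , s) → if r ≡ᵇ i then s ∷ [] else []) H
outTargets≗concatMap i []            = refl
outTargets≗concatMap i ((r , s) ∷ H) with r ≡ᵇ i
... | true  = cong (s ∷_) (outTargets≗concatMap i H)
... | false = outTargets≗concatMap i H

dropIncident≗concatMap : ∀ i H →
  dropIncident H i ≡ concatMap (λ (r , s) → if (r ≡ᵇ i) ∨ (s ≡ᵇ i) then [] else (r , s) ∷ []) H
dropIncident≗concatMap i []            = refl
dropIncident≗concatMap i ((r , s) ∷ H) with (r ≡ᵇ i) ∨ (s ≡ᵇ i)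
... | true  = dropIncident≗concatMap i H
... | false = cong ((r , s) ∷_) (dropIncident≗concatMap i H)

module _ {i : ℕ} where

  inSources-++ : ∀ H H′ → inSources (H ++ H′) i ≡ inSources H i ++ inSources H′ i
  inSources-++ = concatMap-like-++ (inSources≗concatMap i)

  outTargets-++ : ∀ H H′ → outTargets (H ++ H′) i ≡ outTargets H i ++ outTargets H′ i
  outTargets-++ = concatMap-like-++ (outTargets≗concatMap i)

  dropIncident-++ : ∀ H H′ → dropIncident (H ++ H′) i ≡ dropIncident H i ++ dropIncident H′ i
  dropIncident-++ = concatMap-like-++ (dropIncident≗concatMap i)

  inSources-↭ : ∀ {H H′} → H ↭ H′ → inSources H i ↭ inSources H′ i
  inSources-↭ = concatMap-like-↭ (inSources≗concatMap i)

  outTargets-↭ : ∀ {H H′} → H ↭ H′ → outTargets H i ↭ outTargets H′ i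
  outTargets-↭ = concatMap-like-↭ (outTargets≗concatMap i)

  dropIncident-↭ : ∀ {H H′} → H ↭ H′ → dropIncident H i ↭ dropIncident H′ i
  dropIncident-↭ = concatMap-like-↭ (dropIncident≗concatMap i)

  inSources≡[] : ∀ {H} → (∀ {r s} → (r , s) ∈ H → s ≢ i) → inSources H i ≡ []
  inSources≡[] {[]}          _    = refl
  inSources≡[] {(r , s) ∷ H} s≢i rewrite ≢⇒≡ᵇ≡false (s≢i (here refl)) = inSources≡[] (s≢i ∘ there)

  outTargets≡[] : ∀ {H} → (∀ {r s} → (r , s) ∈ H → r ≢ i) → outTargets H i ≡ []
  outTargets≡[] {[]}          _    = refl
  outTargets≡[] {(r , s) ∷ H} r≢i rewrite ≢⇒≡ᵇ≡false (r≢i (here refl)) = outTargets≡[] (r≢i ∘ there)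

  dropIncident≡id : ∀ {H} → (∀ {r s} → (r , s) ∈ H → r ≢ i × s ≢ i) → dropIncident H i ≡ H
  dropIncident≡id {[]}          _     = refl
  dropIncident≡id {(r , s) ∷ H} avoid
    rewrite ≢⇒≡ᵇ≡false (proj₁ (avoid (here refl))) | ≢⇒≡ᵇ≡false (proj₂ (avoid (here refl))) =
    cong ((r , s) ∷_) (dropIncident≡id (avoid ∘ there))

  inSources-∷-into : ∀ r {H} → inSources ((r , i) ∷ H) i ≡ r ∷ inSources H i
  inSources-∷-into r rewrite ≡ᵇ-refl i = refl

  dropIncident-∷-into : ∀ {r H} → r ≢ i → dropIncident ((r , i) ∷ H) i ≡ dropIncident H i
  dropIncident-∷-into r≢i rewrite ≢⇒≡ᵇ≡false r≢i | ≡ᵇ-refl i = refl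

  outTargets-replicate : ∀ c N → outTargets (replicate c (i , N)) i ≡ replicate c N
  outTargets-replicate zero    N = refl
  outTargets-replicate (suc c) N rewrite ≡ᵇ-refl i = cong (N ∷_) (outTargets-replicate c N)

  dropIncident-replicate : ∀ c N → dropIncident (replicate c (i , N)) i ≡ []
  dropIncident-replicate zero    N = refl
  dropIncident-replicate (suc c) N rewrite ≡ᵇ-refl i = dropIncident-replicate c N

-- The reduction tree of Π_n

-- Reduction at a vertex i with a_i > 0, one incoming edge (r , i) and c outgoing edges (i , N).
-- The lists L and R are passed through equations so that trees indexed by Lof and Rof of an
-- arbitrary graph can be compared with them.
module OneIncomingEdge (N i r c : ℕ) where

  L : List (Maybe ℕ)
  L = just r ∷ nothing ∷ []

  R : List ℕ
  R = replicate c N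

  Result : ℕ → Graph
  Result t = replicate (suc t) (r , N) ++ replicate (c ∸ t) (i , N)

  treeEdges-staircase : ∀ t → t < length R → treeEdges i L R (staircase t) ≡ Result t
  treeEdges-staircase t t<q = begin
    map edge (map (zero ,_) (atMost q t) ++ map (suc zero ,_) (atLeast q t))
      ≡⟨ map-++ edge (map (zero ,_) (atMost q t)) _ ⟩
    map edge (map (zero ,_) (atMost q t)) ++ map edge (map (suc zero ,_) (atLeast q t))
      ≡⟨ cong₂ _++_ (sym (map-∘ (atMost q t))) (sym (map-∘ (atLeast q t))) ⟩
    map (edge ∘ (zero ,_)) (atMost q t) ++ map (edge ∘ (suc zero ,_)) (atLeast q t)
      ≡⟨ cong₂ _++_ (map-const (λ y → cong (r ,_) (lookup-replicate′ c N y)) (atMost q t))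
                    (map-const (λ y → cong (i ,_) (lookup-replicate′ c N y)) (atLeast q t)) ⟩
    replicate (length (atMost q t)) (r , N) ++ replicate (length (atLeast q t)) (i , N)
      ≡⟨ cong₂ (λ a b → replicate a (r , N) ++ replicate b (i , N))
               (length-atMost t<q) (trans (length-atLeast q t) (cong (_∸ t) (length-replicate c))) ⟩
    Result t ∎
    where
    open ≡-Reasoning
    q : ℕ
    q = length R
    edge : Fin 2 × Fin q → Edge
    edge (x , y) = srcOf i (lookup L x) , lookup R y

  reduction⁻ : (L′ : List (Maybe ℕ)) (R′ : List ℕ) → L′ ≡ L → R′ ≡ R →
    (T : List (Fin (length L′) × Fin (length R′))) → SpanningTree T → NonCrossing T →
    ∃ λ t → t < c × treeEdges i L′ R′ T ↭ Result t
  reduction⁻ _ _ refl refl T tree nonCrossing with nonCrossingTree⇒staircase tree nonCrossing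
  ... | t , t<q , T↭ = t , subst (t <_) (length-replicate c) t<q ,
                       ↭-trans (map⁺ _ T↭) (↭-reflexive (treeEdges-staircase t t<q))

  reduction⁺ : (L′ : List (Maybe ℕ)) (R′ : List ℕ) → L′ ≡ L → R′ ≡ R → ∀ t → t < c →
    Σ (List (Fin (length L′) × Fin (length R′))) λ T →
      SpanningTree T × NonCrossing T × treeEdges i L′ R′ T ≡ Result t
  reduction⁺ _ _ refl refl t t<c =
    staircase t , staircase-spanningTree t<q , staircase-nonCrossing , treeEdges-staircase t t<q
    where
    t<q : t < length R
    t<q = subst (t <_) (sym (length-replicate c)) t<c

module Stages (n : ℕ) where

  N : ℕ
  N = suc n

  prefix : ℕ → Graph
  prefix k = concatMap (λ j → (j , suc j) ∷ (j , N) ∷ []) (map suc (upTo k))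

  prefix-suc : ∀ k → prefix (suc k) ≡ prefix k ++ (suc k , 2 + k) ∷ (suc k , N) ∷ []
  prefix-suc k = begin
    concatMap edges (map suc (upTo (suc k)))      ≡⟨ cong (concatMap edges ∘ map suc) (upTo-∷ʳ k) ⟨
    concatMap edges (map suc (upTo k ++ k ∷ []))  ≡⟨ cong (concatMap edges) (map-++ suc (upTo k) (k ∷ [])) ⟩
    concatMap edges (map suc (upTo k) ++ suc k ∷ []) ≡⟨ concatMap-++ edges (map suc (upTo k)) (suc k ∷ []) ⟩
    prefix k ++ edges (suc k) ++ []                ≡⟨ cong (prefix k ++_) (++-identityʳ (edges (suc k))) ⟩
    prefix k ++ edges (suc k)                      ∎
    where
    open ≡-Reasoning
    edges : ℕ → Graph
    edges j = (j , suc j) ∷ (j , N) ∷ []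

  ∈-prefix⁻ : ∀ k {r s} → (r , s) ∈ prefix k → r ≤ k × (s ≡ suc r ⊎ s ≡ N)
  ∈-prefix⁻ k e∈ with find (∈-concatMap⁻ _ {xs = map suc (upTo k)} e∈)
  ... | j , j∈ , e∈edges with ∈-map⁻ suc j∈
  ...   | j′ , j′∈ , refl with e∈edges
  ...     | here refl         = ∈-upTo⁻ j′∈ , inj₁ refl
  ...     | there (here refl) = ∈-upTo⁻ j′∈ , inj₂ refl

  ∈-gm⁻ : ∀ s ms {r s′} → (r , s′) ∈ gm N s ms → s ≤ r × s′ ≡ N
  ∈-gm⁻ s (m ∷ ms) e∈ with ∈-++⁻ (replicate m (s , N)) e∈
  ... | inj₁ e∈rep with ∈-replicate⁻ m e∈rep
  ...   | refl = ≤-refl , refl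
  ∈-gm⁻ s (m ∷ ms) e∈ | inj₂ e∈gm with ∈-gm⁻ (suc s) ms e∈gm
  ...   | s<r , refl = ≤-trans (n≤1+n s) s<r , refl

  -- The graphs of the reduction tree after the vertices k+2, …, n have been reduced:
  -- ms lists the multiplicities m_{k+2}, …, m_n already fixed.
  stage : ℕ → ℕ → List ℕ → Graph
  stage k c ms = prefix k ++ replicate c (suc k , N) ++ gm N (2 + k) ms

  module AtVertex (k c : ℕ) (ms : List ℕ) (i≤n : 2 + k ≤ n) where

    i : ℕ
    i = 2 + k

    N≢i : N ≢ i
    N≢i N≡i = <-irrefl (sym N≡i) (s≤s i≤n)

    rest : Graph
    rest = replicate c (i , N) ++ gm N (suc i) ms

    stage-split : stage (suc k) c ms ≡ prefix k ++ (suc k , i) ∷ (suc k , N) ∷ rest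
    stage-split = trans (cong (_++ rest) (prefix-suc k)) (++-assoc (prefix k) _ rest)

    prefix-avoids : ∀ {r s} → (r , s) ∈ prefix k → r ≢ i × s ≢ i
    prefix-avoids e∈ with ∈-prefix⁻ k e∈
    ... | r≤k , inj₁ refl = <⇒≢ (s≤s (m≤n⇒m≤1+n r≤k)) , <⇒≢ (s≤s (s≤s r≤k))
    ... | r≤k , inj₂ refl = <⇒≢ (s≤s (m≤n⇒m≤1+n r≤k)) , N≢i

    gm-avoids : ∀ {r s} → (r , s) ∈ gm N (suc i) ms → r ≢ i × s ≢ i
    gm-avoids e∈ with ∈-gm⁻ (suc i) ms e∈
    ... | i<r , refl = (λ { refl → <-irrefl refl i<r }) , N≢i

    rest-into-N : ∀ {r s} → (r , s) ∈ rest → s ≢ i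
    rest-into-N e∈ with ∈-++⁻ (replicate c (i , N)) e∈
    ... | inj₁ e∈rep with ∈-replicate⁻ c e∈rep
    ...   | refl = N≢i
    rest-into-N e∈ | inj₂ e∈gm = proj₂ (gm-avoids e∈gm)

    suc-k≢i : suc k ≢ i
    suc-k≢i = <⇒≢ ≤-refl

    inSources-stage : inSources (stage (suc k) c ms) i ≡ suc k ∷ []
    inSources-stage = begin
      inSources (stage (suc k) c ms) i
        ≡⟨ cong (λ H → inSources H i) stage-split ⟩
      inSources (prefix k ++ (suc k , i) ∷ (suc k , N) ∷ rest) i
        ≡⟨ inSources-++ (prefix k) _ ⟩
      inSources (prefix k) i ++ inSources ((suc k , i) ∷ (suc k , N) ∷ rest) i
        ≡⟨ cong₂ _++_ (inSources≡[] (λ e∈ → proj₂ (prefix-avoids e∈))) (inSources-∷-into {i} (suc k) {(suc k , N) ∷ rest}) ⟩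
      suc k ∷ inSources ((suc k , N) ∷ rest) i
        ≡⟨ cong (suc k ∷_) (inSources≡[] N-or-rest) ⟩
      suc k ∷ [] ∎
      where
      open ≡-Reasoning
      N-or-rest : ∀ {r s} → (r , s) ∈ (suc k , N) ∷ rest → s ≢ i
      N-or-rest (here refl) = N≢i
      N-or-rest (there e∈)  = rest-into-N e∈

    outTargets-stage : outTargets (stage (suc k) c ms) i ≡ replicate c N
    outTargets-stage = begin
      outTargets (stage (suc k) c ms) i
        ≡⟨ outTargets-++ (prefix (suc k)) rest ⟩
      outTargets (prefix (suc k)) i ++ outTargets rest i
        ≡⟨ cong₂ _++_ (outTargets≡[] from-below) (outTargets-++ (replicate c (i , N)) _) ⟩
      outTargets (replicate c (i , N)) i ++ outTargets (gm N (suc i) ms) i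
        ≡⟨ cong₂ _++_ (outTargets-replicate c N) (outTargets≡[] (proj₁ ∘ gm-avoids)) ⟩
      replicate c N ++ []
        ≡⟨ ++-identityʳ (replicate c N) ⟩
      replicate c N ∎
      where
      open ≡-Reasoning
      from-below : ∀ {r s} → (r , s) ∈ prefix (suc k) → r ≢ i
      from-below e∈ = <⇒≢ (s≤s (proj₁ (∈-prefix⁻ (suc k) e∈)))

    dropIncident-stage : dropIncident (stage (suc k) c ms) i ≡ prefix k ++ (suc k , N) ∷ gm N (suc i) ms
    dropIncident-stage = begin
      dropIncident (stage (suc k) c ms) i
        ≡⟨ cong (λ H → dropIncident H i) stage-split ⟩
      dropIncident (prefix k ++ (suc k , i) ∷ (suc k , N) ∷ rest) i
        ≡⟨ dropIncident-++ (prefix k) _ ⟩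
      dropIncident (prefix k) i ++ dropIncident ((suc k , i) ∷ (suc k , N) ∷ rest) i
        ≡⟨ cong₂ _++_ (dropIncident≡id prefix-avoids) (dropIncident-∷-into {i} {H = (suc k , N) ∷ rest} suc-k≢i) ⟩
      prefix k ++ dropIncident ((suc k , N) ∷ rest) i
        ≡⟨ cong (prefix k ++_) (dropIncident-++ ((suc k , N) ∷ []) rest) ⟩
      prefix k ++ dropIncident ((suc k , N) ∷ []) i ++ dropIncident rest i
        ≡⟨ cong (prefix k ++_) (cong₂ _++_ (dropIncident≡id N-edge) (dropIncident-++ (replicate c (i , N)) _)) ⟩
      prefix k ++ (suc k , N) ∷ dropIncident (replicate c (i , N)) i ++ dropIncident (gm N (suc i) ms) i
        ≡⟨ cong (λ H → prefix k ++ (suc k , N) ∷ H) (cong₂ _++_ (dropIncident-replicate c N) (dropIncident≡id {H = gm N (suc i) ms} gm-avoids)) ⟩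
      prefix k ++ (suc k , N) ∷ gm N (suc i) ms ∎
      where
      open ≡-Reasoning
      N-edge : ∀ {r s} → (r , s) ∈ (suc k , N) ∷ [] → r ≢ i × s ≢ i
      N-edge (here refl) = suc-k≢i , N≢i

    open OneIncomingEdge N i (suc k) c

    module _ {H : Graph} (H↭ : H ↭ stage (suc k) c ms) where

      inSources-H : inSources H i ≡ suc k ∷ []
      inSources-H = ↭-singleton-inv (↭-trans (inSources-↭ H↭) (↭-reflexive inSources-stage))

      outTargets-H : outTargets H i ≡ replicate c N
      outTargets-H = ↭-replicate-inv c (↭-trans (outTargets-↭ H↭) (↭-reflexive outTargets-stage))

      Lof-H : Lof false H i ≡ L
      Lof-H = cong (λ rs → map just rs ++ nothing ∷ []) inSources-H

      reduceBy-H : ∀ T t → treeEdges i (Lof false H i) (Rof H i) T ↭ Result t →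
                   reduceBy N false i H T ↭ stage k (2 + t) ((c ∸ t) ∷ ms)
      reduceBy-H T t T↦ = begin
        dropIncident H i ++ treeEdges i (Lof false H i) (Rof H i) T ++ []
          ↭⟨ ++⁺ʳ _ (↭-trans (dropIncident-↭ H↭) (↭-reflexive dropIncident-stage)) ⟩
        (prefix k ++ (suc k , N) ∷ G) ++ treeEdges i (Lof false H i) (Rof H i) T ++ []
          ↭⟨ ++⁺ˡ (prefix k ++ (suc k , N) ∷ G) (++⁺ʳ [] T↦) ⟩
        (prefix k ++ (suc k , N) ∷ G) ++ (X ++ Y) ++ []
          ≡⟨ cong ((prefix k ++ (suc k , N) ∷ G) ++_) (++-identityʳ (X ++ Y)) ⟩
        (prefix k ++ (suc k , N) ∷ G) ++ X ++ Y
          ≡⟨ ++-assoc (prefix k) _ (X ++ Y) ⟩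
        prefix k ++ (suc k , N) ∷ G ++ X ++ Y
          ↭⟨ ++⁺ˡ (prefix k) (prep (suc k , N) (↭-++-comm G (X ++ Y))) ⟩
        prefix k ++ (suc k , N) ∷ (X ++ Y) ++ G
          ≡⟨ cong (λ H′ → prefix k ++ (suc k , N) ∷ H′) (++-assoc X Y G) ⟩
        stage k (2 + t) ((c ∸ t) ∷ ms) ∎
        where
        open PermutationReasoning
        G : Graph
        G = gm N (suc i) ms
        X : Graph
        X = replicate (suc t) (suc k , N)
        Y : Graph
        Y = replicate (c ∸ t) (i , N)

      step⁻ : ∀ {H′} → Step N false i H H′ → ∃ λ t → t < c × H′ ↭ stage k (2 + t) ((c ∸ t) ∷ ms)
      step⁻ (noIncoming none) with () ← trans (sym inSources-H) none
      step⁻ (reduce _ T tree nonCrossing)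
        with t , t<c , T↦ ← reduction⁻ (Lof false H i) (Rof H i) Lof-H outTargets-H T tree nonCrossing
        = t , t<c , reduceBy-H T t T↦

      step⁺ : ∀ t → t < c → Σ Graph λ H′ → Step N false i H H′ × H′ ↭ stage k (2 + t) ((c ∸ t) ∷ ms)
      step⁺ t t<c
        with T , tree , nonCrossing , T↦ ← reduction⁺ (Lof false H i) (Rof H i) Lof-H outTargets-H t t<c
        = reduceBy N false i H T , reduce (λ none → has-input (trans (sym inSources-H) none)) T tree nonCrossing ,
          reduceBy-H T t (↭-reflexive T↦)
        where
        has-input : suc k ∷ [] ≢ []
        has-input ()

cellTypes : (k c : ℕ) → List (Vec ℕ (suc k))
cellTypes zero    c = (c ∷ []) ∷ []
cellTypes (suc k) c = concatMap (λ t → map (_∷ʳ (c ∸ t)) (cellTypes k (2 + t))) (upTo c)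

∈-cellTypes⁺ : ∀ {k c t v} → t < c → v ∈ cellTypes k (2 + t) → v ∷ʳ (c ∸ t) ∈ cellTypes (suc k) c
∈-cellTypes⁺ {k} {c} t<c v∈ = ∈-concatMap⁺ (λ t → map (_∷ʳ (c ∸ t)) (cellTypes k (2 + t))) (lose (∈-upTo⁺ t<c) (∈-map⁺ _ v∈))

∈-cellTypes⁻ : ∀ {k c w} → w ∈ cellTypes (suc k) c →
  ∃ λ t → t < c × ∃ λ v → v ∈ cellTypes k (2 + t) × w ≡ v ∷ʳ (c ∸ t)
∈-cellTypes⁻ {k} {c} w∈ with find (∈-concatMap⁻ (λ t → map (_∷ʳ (c ∸ t)) (cellTypes k (2 + t))) w∈)
... | t , t∈ , w∈t with ∈-map⁻ (_∷ʳ (c ∸ t)) w∈t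
...   | v , v∈ , w≡ = t , ∈-upTo⁻ t∈ , v , v∈ , w≡

cellTypes-unique : ∀ k c → Unique (cellTypes k c)
cellTypes-unique zero    c = ListAll.[] ∷ []
cellTypes-unique (suc k) c =
  concatMap-unique _ (Unique.upTo⁺ c) (λ t → Unique.map⁺ (∷ʳ-injectiveˡ _ _) (cellTypes-unique k (2 + t))) same-t
  where
  same-t : ∀ {t t′ w} → t ∈ upTo c → t′ ∈ upTo c →
           w ∈ map (_∷ʳ (c ∸ t)) (cellTypes k (2 + t)) → w ∈ map (_∷ʳ (c ∸ t′)) (cellTypes k (2 + t′)) → t ≡ t′
  same-t t∈ t′∈ w∈ w∈′ with ∈-map⁻ _ w∈ | ∈-map⁻ _ w∈′
  ... | v , _ , refl | v′ , _ , eq =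
    ∸-cancelˡ-≡ (<⇒≤ (∈-upTo⁻ t∈)) (<⇒≤ (∈-upTo⁻ t′∈)) (∷ʳ-injectiveʳ v v′ eq)

length-cellTypes : ∀ k c → length (cellTypes k c) ≡ ballot k c
length-cellTypes zero    c = refl
length-cellTypes (suc k) c =
  trans (length-concatMap-map (λ t → _∷ʳ (c ∸ t)) (λ t → cellTypes k (2 + t)) (upTo c)) (count c)
  where
  F : ℕ → List (Vec ℕ (suc k))
  F t = cellTypes k (2 + t)
  count : ∀ c → length (concatMap F (upTo c)) ≡ ballot (suc k) c
  count zero    = refl
  count (suc c) = begin
    length (concatMap F (upTo (suc c)))            ≡⟨ cong (length ∘ concatMap F) (upTo-∷ʳ c) ⟨
    length (concatMap F (upTo c ++ c ∷ []))        ≡⟨ cong length (concatMap-++ F (upTo c) (c ∷ [])) ⟩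
    length (concatMap F (upTo c) ++ F c ++ [])     ≡⟨ length-++ (concatMap F (upTo c)) ⟩
    length (concatMap F (upTo c)) + length (F c ++ [])
      ≡⟨ cong₂ _+_ (count c) (trans (cong length (++-identityʳ (F c))) (length-cellTypes k (2 + c))) ⟩
    ballot (suc k) c + ballot k (2 + c)            ∎
    where open ≡-Reasoning

module Leaves (n : ℕ) where

  open Stages n

  module _ {s : ℕ} (s<N : s < N) (x : ℕ) (xs : List ℕ) where

    private
      later : ∀ {r s′} → (r , s′) ∈ gm N (suc s) xs → r ≢ s × s′ ≢ s
      later e∈ with ∈-gm⁻ (suc s) xs e∈
      ... | s<r , refl = (λ { refl → <⇒≢ s<r refl }) , (λ { refl → <⇒≢ s<N refl })

    outTargets-gm : outTargets (gm N s (x ∷ xs)) s ≡ replicate x N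
    outTargets-gm = begin
      outTargets (replicate x (s , N) ++ gm N (suc s) xs) s
        ≡⟨ outTargets-++ (replicate x (s , N)) _ ⟩
      outTargets (replicate x (s , N)) s ++ outTargets (gm N (suc s) xs) s
        ≡⟨ cong₂ _++_ (outTargets-replicate x N) (outTargets≡[] (proj₁ ∘ later)) ⟩
      replicate x N ++ []
        ≡⟨ ++-identityʳ _ ⟩
      replicate x N ∎
      where open ≡-Reasoning

    dropIncident-gm : dropIncident (gm N s (x ∷ xs)) s ≡ gm N (suc s) xs
    dropIncident-gm = begin
      dropIncident (replicate x (s , N) ++ gm N (suc s) xs) s
        ≡⟨ dropIncident-++ (replicate x (s , N)) _ ⟩
      dropIncident (replicate x (s , N)) s ++ dropIncident (gm N (suc s) xs) s
        ≡⟨ cong₂ _++_ (dropIncident-replicate x N) (dropIncident≡id later) ⟩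
      gm N (suc s) xs ∎
      where open ≡-Reasoning

  gm-↭-injective : ∀ {k} s (u v : Vec ℕ k) → s + k ≤ N → gm N s (toList u) ↭ gm N s (toList v) → u ≡ v
  gm-↭-injective s []      []      _     _ = refl
  gm-↭-injective {suc k} s (x ∷ u) (y ∷ v) bound p = cong₂ _∷_ x≡y (gm-↭-injective (suc s) u v bound′ tails)
    where
    bound′ : suc s + k ≤ N
    bound′ = subst (_≤ N) (+-suc s k) bound
    s<N : s < N
    s<N = ≤-trans (s≤s (m≤m+n s k)) bound′
    x≡y : x ≡ y
    x≡y = begin
      x                                                ≡⟨ length-replicate x ⟨
      length (replicate x N)                           ≡⟨ cong length (outTargets-gm s<N x (toList u)) ⟨
      length (outTargets (gm N s (toList (x ∷ u))) s)  ≡⟨ ↭-length (outTargets-↭ p) ⟩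
      length (outTargets (gm N s (toList (y ∷ v))) s)  ≡⟨ cong length (outTargets-gm s<N y (toList v)) ⟩
      length (replicate y N)                           ≡⟨ length-replicate y ⟩
      y                                                ∎
      where open ≡-Reasoning
    tails : gm N (suc s) (toList u) ↭ gm N (suc s) (toList v)
    tails = subst₂ _↭_ (dropIncident-gm s<N x (toList u)) (dropIncident-gm s<N y (toList v)) (dropIncident-↭ p)

  module _ (a : List ℕ) (a>0 : ∀ j → nthIsZero a j ≡ false) where

    private
      toList-∷ʳ-++ : ∀ {k} (v : Vec ℕ k) x ms → toList v ++ x ∷ ms ≡ toList (v ∷ʳ x) ++ ms
      toList-∷ʳ-++ v x ms = trans (sym (++-assoc (toList v) (x ∷ []) ms)) (cong (_++ ms) (sym (toList-∷ʳ x v)))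

    leaves⁻ : ∀ k c ms {H H′} → suc k ≤ n → H ↭ stage k c ms → Run N a (suc k) H H′ →
              ∃ λ v → v ∈ cellTypes k c × H′ ↭ gm N 1 (toList v ++ ms)
    leaves⁻ zero    c ms _   H↭ done1 = c ∷ [] , here refl , H↭
    leaves⁻ (suc k) c ms k<n H↭ (next first rest)
      with t , t<c , H′↭ ← AtVertex.step⁻ k c ms k<n H↭ (subst (λ b → Step N b _ _ _) (a>0 (suc k)) first)
      with v , v∈ , H″↭ ← leaves⁻ k (2 + t) ((c ∸ t) ∷ ms) (<⇒≤ k<n) H′↭ rest
      = v ∷ʳ (c ∸ t) , ∈-cellTypes⁺ t<c v∈ , subst (λ xs → _ ↭ gm N 1 xs) (toList-∷ʳ-++ v (c ∸ t) ms) H″↭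

    leaves⁺ : ∀ k c ms {H} → suc k ≤ n → H ↭ stage k c ms → ∀ {w} → w ∈ cellTypes k c →
              ∃ λ H′ → Run N a (suc k) H H′ × H′ ↭ gm N 1 (toList w ++ ms)
    leaves⁺ zero    c ms {H} _ H↭ (here refl) = H , done1 , H↭
    leaves⁺ (suc k) c ms k<n H↭ w∈
      with t , t<c , v , v∈ , refl ← ∈-cellTypes⁻ {k} {c} w∈
      with H′ , first , H′↭ ← AtVertex.step⁺ k c ms k<n H↭ t t<c
      with H″ , rest , H″↭ ← leaves⁺ k (2 + t) ((c ∸ t) ∷ ms) (<⇒≤ k<n) H′↭ v∈
      = H″ , next (subst (λ b → Step N b _ _ _) (sym (a>0 (suc k))) first) rest ,
        subst (λ xs → H″ ↭ gm N 1 xs) (toList-∷ʳ-++ v (c ∸ t) ms) H″↭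

nthIsZero-positive : ∀ {n} (a : Vec ℕ n) → All (λ x → 0 < x) a → ∀ j → nthIsZero (toList a) j ≡ false
nthIsZero-positive []      _             j       = refl
nthIsZero-positive (x ∷ a) (s≤s _ ∷ _)   zero    = refl
nthIsZero-positive (x ∷ a) (_ ∷ a>0)     (suc j) = nthIsZero-positive a a>0 j

corollary6p3 : (n : ℕ) → 1 ≤ n → (a : Vec ℕ n) → All (λ x → 0 < x) a →
    Σ (List (Vec ℕ n)) (λ ms →
      Unique ms
      × ((m : Vec ℕ n) → (m ∈ ms → IsCellType n a m) × (IsCellType n a m → m ∈ ms))
      × length ms ≡ catalan n)
corollary6p3 zero    ()
corollary6p3 (suc k) _ a a>0 =
  cellTypes k 2 , cellTypes-unique k 2 , (λ m → realised m , only m) ,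
  trans (length-cellTypes k 2) (sym (catalan≡ballot k))
  where
  open Stages (suc k)
  open Leaves (suc k)
  positive : ∀ j → nthIsZero (toList a) j ≡ false
  positive = nthIsZero-positive a a>0
  start : Pi (suc k) ↭ stage k 2 []
  start = ↭-reflexive (prefix-suc k)
  realised : ∀ m → m ∈ cellTypes k 2 → IsCellType (suc k) a m
  realised m m∈ with H , run , H↭ ← leaves⁺ (toList a) positive k 2 [] ≤-refl start m∈
    = H , run , subst (λ xs → H ↭ gm N 1 xs) (++-identityʳ (toList m)) H↭
  only : ∀ m → IsCellType (suc k) a m → m ∈ cellTypes k 2
  only m (H , run , H↭m) with v , v∈ , H↭v ← leaves⁻ (toList a) positive k 2 [] ≤-refl start run
    = subst (_∈ cellTypes k 2) (sym m≡v) v∈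
    where
    m≡v : m ≡ v
    m≡v = gm-↭-injective 1 m v ≤-refl
            (↭-trans (↭-sym H↭m) (subst (λ xs → H ↭ gm N 1 xs) (++-identityʳ (toList v)) H↭v))
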